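{- (1) The commutator subgroup $[\Omega_\infty,\Omega_\infty]$ of $\Omega_\infty$ is not topologically finitely generated. (2) Let $I\subseteq\bigoplus_{i\geq1}\mathbb{F}_2$ be non-empty and let $M_I=\bigcap_{v\in I}M_v$. Then $M_I$ is not topologically finitely generated.
   Context: $\Omega_\infty$ is the automorphism group of the infinite rooted regular binary tree $T_\infty$, whose vertices are finite binary words. Every $\sigma\in\Omega_\infty$ has a digital representation $(\ldots,\sigma_n,\ldots,\sigma_1)$ with $\sigma_n\in\mathbb{F}_2^{2^{n-1}}$ indexed by words $w$ of length $n-1$, determined by $\sigma(wx)=\sigma(w)(x+\sigma_n(w))$ for $x\in\{0,1\}$. Let $\phi_n\colon\Omega_\infty\to\mathbb{F}_2$ send $\sigma$ to the sum of the coordinates of $\sigma_n$ (a continuous homomorphism). For $v=(v_n)_{n\geq1}\in\bigoplus_{n\geq1}\mathbb{F}_2$ (finitely supported vectors), $M_v=\ker\left(\sum_{n\geq1}v_n\phi_n\right)$; for nonzero $v$ these are exactly the maximal closed subgroups of $\Omega_\infty$. -}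

module Defs where

open import Data.Bool using (Bool; true; false; _xor_; _∧_)
open import Data.List using (List; []; _∷_; map; foldr; length; concatMap)
open import Data.List.Membership.Propositional using (_∈_)
open import Data.List.Relation.Unary.All using (All)
open import Data.Nat using (ℕ; zero; suc; _<_)
open import Data.Product using (Σ; ∃; _×_; _,_)
open import Relation.Binary.PropositionalEquality using (_≡_)

-- Finite binary words = vertices of the tree T∞.
Word : Set
Word = List Bool

-- An element σ of Ω∞ is given by its digital representation: the function
-- Ω w = σ_{n}(w) for a word w of length n-1  (so σ_n = Ω restricted to words
-- of length n-1).  Every such function is an automorphism and conversely.
Ω∞ : Set
Ω∞ = Word → Bool

sect : Ω∞ → Bool → Ω∞
sect σ x u = σ (x ∷ u)

-- Action on the tree: σ(wx) = σ(w)(x + σ_n(w)), equivalently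
-- σ(x u) = (x + σ_1) σ|_x(u).
act : Ω∞ → Word → Word
act σ []      = []
act σ (x ∷ w) = (x xor σ []) ∷ act (sect σ x) w

actInv : Ω∞ → Word → Word
actInv σ []      = []
actInv σ (y ∷ w) = (y xor σ []) ∷ actInv (sect σ (y xor σ [])) w

-- Group structure: composition (σ ∘ τ)(u) = σ(τ(u)), identity, inverse.
_∘Ω_ : Ω∞ → Ω∞ → Ω∞
(σ ∘Ω τ) w = τ w xor σ (act τ w)

idΩ : Ω∞
idΩ _ = false

invΩ : Ω∞ → Ω∞
invΩ σ w = σ (actInv σ w)

_≈Ω_ : Ω∞ → Ω∞ → Set
σ ≈Ω τ = ∀ w → σ w ≡ τ w

comm : Ω∞ → Ω∞ → Ω∞
comm a b = invΩ a ∘Ω (invΩ b ∘Ω (a ∘Ω b))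

data CommProd : Ω∞ → Set where
  c-id  : CommProd idΩ
  c-mul : ∀ a b {g} → CommProd g → CommProd (comm a b ∘Ω g)

InCommutator : Ω∞ → Set
InCommutator σ = ∃ λ g → CommProd g × (g ≈Ω σ)

data Gen (S : List Ω∞) : Ω∞ → Set where
  g-id  : Gen S idΩ
  g-mul : ∀ {s g} → s ∈ S → Gen S g → Gen S (s ∘Ω g)
  g-inv : ∀ {s g} → s ∈ S → Gen S g → Gen S (invΩ s ∘Ω g)

-- σ and τ agree on the first n levels (i.e. σ_k = τ_k for k ≤ n):
-- they have the same image in Ω_n = Aut(T_n).
AgreeUpTo : ℕ → Ω∞ → Ω∞ → Set
AgreeUpTo n σ τ = ∀ w → length w < n → σ w ≡ τ w

-- σ lies in the closure (w.r.t. the profinite topology of Ω∞) of the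
-- subgroup generated by S: every basic neighbourhood of σ meets ⟨S⟩.
InClosureGen : List Ω∞ → Ω∞ → Set
InClosureGen S σ = ∀ n → ∃ λ g → Gen S g × AgreeUpTo n g σ

TopFinGen : (Ω∞ → Set) → Set
TopFinGen H = ∃ λ (S : List Ω∞) → All H S × (∀ σ → H σ → InClosureGen S σ)

words : ℕ → List Word
words zero    = [] ∷ []
words (suc n) = concatMap (λ w → (false ∷ w) ∷ (true ∷ w) ∷ []) (words n)

sumF2 : List Bool → Bool
sumF2 = foldr _xor_ false

-- φ_{k+1}(σ) = sum of the coordinates of σ_{k+1} (words of length k).
φ : ℕ → Ω∞ → Bool
φ k σ = sumF2 (map σ (words k))

-- A finitely supported vector v ∈ ⊕_{n≥1} F₂ is given by the finite list
-- (v_1, …, v_m) (all later coordinates 0).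
FinVec : Set
FinVec = List Bool

-- Σ_{n≥1} v_n φ_n(σ)   (the list's head is v_1).
φsum : FinVec → Ω∞ → Bool
φsum v σ = go 0 v
  where
  go : ℕ → List Bool → Bool
  go k []       = false
  go k (b ∷ bs) = (b ∧ φ k σ) xor go (suc k) bs

M : FinVec → Ω∞ → Set
M v σ = φsum v σ ≡ false

M[_] : (FinVec → Set) → Ω∞ → Set
M[ I ] σ = ∀ v → I v → M v σ

-- For each level m the map σ ↦ (Σ_{|w|=m} σ(0w), Σ_{|w|=m} σ(1w)) ∈ F₂² is a crossed
-- homomorphism (for the action of Ω∞ on F₂² by swapping the two coordinates through σ₁)
-- and depends only on the first m+2 levels.  Hence for g in the closure of ⟨S⟩ the
-- vector of its m-th first coordinates, m < N, lies in the span of the 2|S| vectors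
-- attached to the generators.  The commutators c_n = [t, f_n] of the root swap t with
-- the automorphism f_n flipping only at the vertex 0ⁿ⁺¹ lie in every M_v, and their
-- vectors are the unit vectors e_n; taking N = 2|S|+1 contradicts dim F₂^N = N.
module Submission where

open import Defs
open import Algebra.Bundles using (CommutativeRing)
open import Data.Bool using (Bool; true; false; not; _xor_; _∧_)
open import Data.Bool.Properties
  using (xor-∧-commutativeRing; xor-assoc; xor-comm; xor-identityʳ; xor-same; ∧-zeroʳ; ∧-distribʳ-xor)
  renaming (_≟_ to _≟ᵇ_)
open import Data.Empty using (⊥-elim)
open import Data.Fin using (Fin; zero; toℕ; punchIn)
open import Data.Fin.Properties using (any?; toℕ-injective; toℕ<n; punchIn-injective; punchInᵢ≢i)
  renaming (_≟_ to _≟ᶠ_)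
open import Data.List using (List; []; _∷_; map; length; concatMap)
open import Data.List.Membership.Propositional using (_∈_)
open import Data.List.Membership.Propositional.Properties using (∈-map⁺)
open import Data.List.Properties using (length-map)
open import Data.List.Relation.Unary.Any using (here; there)
open import Data.Nat using (ℕ; zero; suc; _*_; _≤_; _<_; z≤n; s≤s)
open import Data.Nat.Properties using (*-suc; n≮n) renaming (_≟_ to _≟ℕ_)
open import Data.Product using (∃; _×_; _,_)
open import Function.Bundles using (mk⇔)
open import Relation.Binary.PropositionalEquality
open import Relation.Nullary using (¬_; yes; no; does)
open import Relation.Nullary.Decidable using (dec-false; does-⇔)

open import Algebra.Properties.CommutativeSemigroup
  (CommutativeRing.+-commutativeSemigroup xor-∧-commutativeRing) using (interchange)

xor-cancelʳ : ∀ x y → (x xor y) xor y ≡ x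
xor-cancelʳ x y = trans (xor-assoc x y y) (trans (cong (x xor_) (xor-same y)) (xor-identityʳ x))

xor≡false⇒≡ : ∀ {x y} → x xor y ≡ false → x ≡ y
xor≡false⇒≡ {false} {false} _ = refl
xor≡false⇒≡ {true}  {true}  _ = refl

V : ℕ → Set
V N = Fin N → Bool

0v : ∀ {N} → V N
0v _ = false

_⊕_ : ∀ {N} → V N → V N → V N
(u ⊕ w) i = u i xor w i

unit : ∀ {N} → Fin N → V N
unit k i = does (k ≟ᶠ i)

data Span {N} (L : List (V N)) : V N → Set where
  span-0 : ∀ {u} → u ≗ 0v → Span L u
  span-⊕ : ∀ {l u w} → l ∈ L → Span L u → w ≗ u ⊕ l → Span L w

Span-≗ : ∀ {N} {L : List (V N)} {u w} → Span L u → u ≗ w → Span L w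
Span-≗ (span-0 u≗0) u≗w = span-0 λ i → trans (sym (u≗w i)) (u≗0 i)
Span-≗ (span-⊕ l∈L s u≗) u≗w = span-⊕ l∈L s λ i → trans (sym (u≗w i)) (u≗ i)

Span-[] : ∀ {N} {u : V N} → Span [] u → u ≗ 0v
Span-[] (span-0 u≗0) = u≗0

Span-drop-null : ∀ {N} {l : V N} {L u} → l ≗ 0v → Span (l ∷ L) u → Span L u
Span-drop-null l≗0 (span-0 u≗0) = span-0 u≗0
Span-drop-null l≗0 (span-⊕ (there l∈L) s w≗) = span-⊕ l∈L (Span-drop-null l≗0 s) w≗
Span-drop-null l≗0 (span-⊕ {u = u} (here refl) s w≗) =
  Span-≗ (Span-drop-null l≗0 s) λ i →
    sym (trans (w≗ i) (trans (cong (u i xor_) (l≗0 i)) (xor-identityʳ (u i))))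

record IsLinear {M N} (g : V M → V N) : Set where
  field
    map-≗ : ∀ {u w} → u ≗ w → g u ≗ g w
    map-0 : g 0v ≗ 0v
    map-⊕ : ∀ u w → g (u ⊕ w) ≗ g u ⊕ g w

Span-map : ∀ {M N} {g : V M → V N} → IsLinear g → ∀ {L u} → Span L u → Span (map g L) (g u)
Span-map lin (span-0 u≗0) = span-0 λ i → trans (map-≗ u≗0 i) (map-0 i)
  where open IsLinear lin
Span-map {g = g} lin (span-⊕ {l} {u} l∈L s w≗) =
  span-⊕ (∈-map⁺ g l∈L) (Span-map lin s) λ i → trans (map-≗ w≗ i) (map-⊕ u l i)
  where open IsLinear lin

IsPivot : ∀ {N} → V N → Fin N → Set
IsPivot l p = ∀ j → l j ≡ true → l p ≡ true

pivot : ∀ {N} (l : V (suc N)) → ∃ (IsPivot l)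
pivot l with any? (λ i → l i ≟ᵇ true)
... | yes (p , lp) = p , λ _ _ → lp
... | no ¬lp       = zero , λ j lj → ⊥-elim (¬lp (j , lj))

eliminate : ∀ {N} → Fin (suc N) → V (suc N) → V (suc N) → V N
eliminate p l u j = u (punchIn p j) xor (u p ∧ l (punchIn p j))

eliminate-linear : ∀ {N} p (l : V (suc N)) → IsLinear (eliminate p l)
eliminate-linear p l = record
  { map-≗ = λ u≗w j → cong₂ (λ a b → a xor (b ∧ l (punchIn p j))) (u≗w (punchIn p j)) (u≗w p)
  ; map-0 = λ _ → refl
  ; map-⊕ = λ u w j →
      xor-∧-distrib-interchange (u (punchIn p j)) (w (punchIn p j)) (u p) (w p) (l (punchIn p j))
  }
  where
  xor-∧-distrib-interchange : ∀ a b c d x →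
    (a xor b) xor ((c xor d) ∧ x) ≡ (a xor (c ∧ x)) xor (b xor (d ∧ x))
  xor-∧-distrib-interchange a b c d x =
    trans (cong ((a xor b) xor_) (∧-distribʳ-xor x c d)) (interchange a b (c ∧ x) (d ∧ x))

eliminate-pivot : ∀ {N} {p} {l : V (suc N)} → IsPivot l p → eliminate p l l ≗ 0v
eliminate-pivot {p = p} {l} piv j with l (punchIn p j) in lj
... | false = ∧-zeroʳ (l p)
... | true rewrite piv (punchIn p j) lj = refl

eliminate-unit : ∀ {N} p (l : V (suc N)) (k : Fin N) → eliminate p l (unit (punchIn p k)) ≗ unit k
eliminate-unit p l k j
  rewrite dec-false (punchIn p k ≟ᶠ p) (punchInᵢ≢i p k)
        | does-⇔ (mk⇔ (punchIn-injective p k j) (cong (punchIn p))) (punchIn p k ≟ᶠ punchIn p j) (k ≟ᶠ j)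
  = xor-identityʳ _

units-in-Span⇒≤ : ∀ {N} (L : List (V N)) → (∀ k → Span L (unit k)) → N ≤ length L
units-in-Span⇒≤ {zero} L _ = z≤n
units-in-Span⇒≤ {suc N} [] units with Span-[] (units zero) zero
... | ()
units-in-Span⇒≤ {suc N} (l ∷ L) units with pivot l
... | p , piv = s≤s (subst (N ≤_) (length-map g L) (units-in-Span⇒≤ (map g L) units′))
  where
  g = eliminate p l
  units′ : ∀ k → Span (map g L) (unit k)
  units′ k = Span-≗ (Span-drop-null (eliminate-pivot piv)
                                     (Span-map (eliminate-linear p l) (units (punchIn p k))))
                    (eliminate-unit p l k)

levelSum : ℕ → (Word → Bool) → Bool
levelSum zero    f = f []
levelSum (suc m) f = levelSum m (λ w → f (false ∷ w)) xor levelSum m (λ w → f (true ∷ w))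

levelSum-cong : ∀ m {f g : Word → Bool} → (∀ w → length w ≡ m → f w ≡ g w) → levelSum m f ≡ levelSum m g
levelSum-cong zero    f≡g = f≡g [] refl
levelSum-cong (suc m) f≡g =
  cong₂ _xor_ (levelSum-cong m λ w eq → f≡g (false ∷ w) (cong suc eq))
              (levelSum-cong m λ w eq → f≡g (true ∷ w) (cong suc eq))

levelSum-0 : ∀ m → levelSum m (λ _ → false) ≡ false
levelSum-0 zero    = refl
levelSum-0 (suc m) = cong₂ _xor_ (levelSum-0 m) (levelSum-0 m)

levelSum-xor : ∀ m (f g : Word → Bool) → levelSum m (λ w → f w xor g w) ≡ levelSum m f xor levelSum m g
levelSum-xor zero    f g = refl
levelSum-xor (suc m) f g =
  trans (cong₂ _xor_ (levelSum-xor m (λ w → f (false ∷ w)) (λ w → g (false ∷ w)))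
                     (levelSum-xor m (λ w → f (true ∷ w)) (λ w → g (true ∷ w))))
        (interchange (levelSum m (λ w → f (false ∷ w))) (levelSum m (λ w → g (false ∷ w)))
                     (levelSum m (λ w → f (true ∷ w))) (levelSum m (λ w → g (true ∷ w))))

-- act τ permutes each level of the tree.
levelSum-act : ∀ m (f : Word → Bool) τ → levelSum m (λ w → f (act τ w)) ≡ levelSum m f
levelSum-act zero    f τ = refl
levelSum-act (suc m) f τ =
  trans (cong₂ _xor_ (levelSum-act m (λ u → f (τ [] ∷ u)) (sect τ false))
                     (levelSum-act m (λ u → f (not (τ []) ∷ u)) (sect τ true)))
        (swap-children (τ []))
  where
  swap-children : ∀ b → levelSum m (λ w → f (b ∷ w)) xor levelSum m (λ w → f (not b ∷ w))
                      ≡ levelSum m (λ w → f (false ∷ w)) xor levelSum m (λ w → f (true ∷ w))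
  swap-children false = refl
  swap-children true  = xor-comm (levelSum m (λ w → f (true ∷ w))) (levelSum m (λ w → f (false ∷ w)))

sumF2-children : ∀ (f : Word → Bool) ws →
  sumF2 (map f (concatMap (λ w → (false ∷ w) ∷ (true ∷ w) ∷ []) ws))
  ≡ sumF2 (map (λ w → f (false ∷ w) xor f (true ∷ w)) ws)
sumF2-children f []       = refl
sumF2-children f (w ∷ ws) =
  trans (cong (λ r → f (false ∷ w) xor (f (true ∷ w) xor r)) (sumF2-children f ws))
        (sym (xor-assoc (f (false ∷ w)) (f (true ∷ w)) _))

φ≡levelSum : ∀ k σ → φ k σ ≡ levelSum k σ
φ≡levelSum zero    σ = xor-identityʳ (σ [])
φ≡levelSum (suc k) σ =
  trans (sumF2-children σ (words k))
        (trans (φ≡levelSum k (λ w → σ (false ∷ w) xor σ (true ∷ w)))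
               (levelSum-xor k (λ w → σ (false ∷ w)) (λ w → σ (true ∷ w))))

sectSum : ℕ → Ω∞ → Bool → Bool
sectSum m σ x = levelSum m (sect σ x)

sectSum-∘ : ∀ m σ τ x → sectSum m (σ ∘Ω τ) x ≡ sectSum m τ x xor sectSum m σ (x xor τ [])
sectSum-∘ m σ τ x =
  trans (levelSum-xor m (sect τ x) (λ u → sect σ (x xor τ []) (act (sect τ x) u)))
        (cong (sectSum m τ x xor_) (levelSum-act m (sect σ (x xor τ [])) (sect τ x)))

actInv-act : ∀ σ w → actInv σ (act σ w) ≡ w
actInv-act σ []      = refl
actInv-act σ (x ∷ w) rewrite xor-cancelʳ x (σ []) = cong (x ∷_) (actInv-act (sect σ x) w)

invΩ-inverseˡ : ∀ σ → (invΩ σ ∘Ω σ) ≈Ω idΩ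
invΩ-inverseˡ σ w rewrite actInv-act σ w = xor-same (σ w)

sectSum-inv : ∀ m σ x → sectSum m (invΩ σ) x ≡ sectSum m σ (x xor σ [])
sectSum-inv m σ x = begin
  sectSum m (invΩ σ) x
    ≡⟨ cong (sectSum m (invΩ σ)) (sym (xor-cancelʳ x (σ []))) ⟩
  sectSum m (invΩ σ) ((x xor σ []) xor σ [])
    ≡⟨ sym (xor≡false⇒≡ cancel) ⟩
  sectSum m σ (x xor σ [])
    ∎
  where
  open ≡-Reasoning
  cancel : sectSum m σ (x xor σ []) xor sectSum m (invΩ σ) ((x xor σ []) xor σ []) ≡ false
  cancel = trans (sym (sectSum-∘ m (invΩ σ) σ (x xor σ [])))
                 (trans (levelSum-cong m (λ w _ → invΩ-inverseˡ σ ((x xor σ []) ∷ w))) (levelSum-0 m))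

sectSum-comm : ∀ m a b → (∀ x → sectSum m a x ≡ false) →
               ∀ x → sectSum m (comm a b) x ≡ sectSum m b x xor sectSum m b (x xor a [])
sectSum-comm m a b a≡0 x = begin
  sectSum m (invΩ a ∘Ω R) x
    ≡⟨ sectSum-∘ m (invΩ a) R x ⟩
  sectSum m R x xor sectSum m (invΩ a) (x xor R [])
    ≡⟨ cong (sectSum m R x xor_) (trans (sectSum-inv m a (x xor R [])) (a≡0 _)) ⟩
  sectSum m R x xor false
    ≡⟨ xor-identityʳ _ ⟩
  sectSum m R x
    ≡⟨ sectSum-∘ m (invΩ b) (a ∘Ω b) x ⟩
  sectSum m (a ∘Ω b) x xor sectSum m (invΩ b) (x xor (b [] xor a []))
    ≡⟨ cong₂ _xor_ sectSum-ab (sectSum-inv m b (x xor (b [] xor a []))) ⟩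
  sectSum m b x xor sectSum m b ((x xor (b [] xor a [])) xor b [])
    ≡⟨ cong (λ y → sectSum m b x xor sectSum m b y) (swap-out x (b []) (a [])) ⟩
  sectSum m b x xor sectSum m b (x xor a [])
    ∎
  where
  open ≡-Reasoning
  R = invΩ b ∘Ω (a ∘Ω b)
  sectSum-ab : sectSum m (a ∘Ω b) x ≡ sectSum m b x
  sectSum-ab = trans (sectSum-∘ m a b x)
                     (trans (cong (sectSum m b x xor_) (a≡0 (x xor b []))) (xor-identityʳ (sectSum m b x)))
  swap-out : ∀ x c d → (x xor (c xor d)) xor c ≡ x xor d
  swap-out x c d = trans (cong (λ e → (x xor e) xor c) (xor-comm c d))
                         (trans (cong (_xor c) (sym (xor-assoc x d c))) (xor-cancelʳ (x xor d) c))

rootSwap : Ω∞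
rootSwap []      = true
rootSwap (_ ∷ _) = false

spike : ℕ → Ω∞
spike zero    []          = true
spike zero    (_ ∷ _)     = false
spike (suc n) []          = false
spike (suc n) (false ∷ w) = spike n w
spike (suc n) (true ∷ w)  = false

witness : ℕ → Ω∞
witness n = comm rootSwap (spike (suc n))

δ : ℕ → ℕ → Bool
δ m n = does (m ≟ℕ n)

levelSum-spike : ∀ n m → levelSum m (spike n) ≡ δ n m
levelSum-spike zero    zero    = refl
levelSum-spike (suc n) zero    = refl
levelSum-spike zero    (suc m) = cong₂ _xor_ (levelSum-0 m) (levelSum-0 m)
levelSum-spike (suc n) (suc m) =
  trans (cong₂ _xor_ (levelSum-spike n m) (levelSum-0 m)) (xor-identityʳ (δ n m))

sectSum-witness : ∀ n m x → sectSum m (witness n) x ≡ δ n m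
sectSum-witness n m x =
  trans (sectSum-comm m rootSwap (spike (suc n)) (λ _ → levelSum-0 m) x) (children x)
  where
  children : ∀ x → sectSum m (spike (suc n)) x xor sectSum m (spike (suc n)) (x xor true) ≡ δ n m
  children false = trans (cong₂ _xor_ (levelSum-spike n m) (levelSum-0 m)) (xor-identityʳ (δ n m))
  children true  = cong₂ _xor_ (levelSum-0 m) (levelSum-spike n m)

φ-witness : ∀ n k → φ k (witness n) ≡ false
φ-witness n zero    = refl
φ-witness n (suc k) =
  trans (φ≡levelSum (suc k) (witness n))
        (trans (cong₂ _xor_ (sectSum-witness n k false) (sectSum-witness n k true)) (xor-same (δ n k)))

WeightedTail : Ω∞ → (ℕ → List Bool → Bool) → Set
WeightedTail σ F = (∀ k → F k [] ≡ false) × (∀ k b bs → F k (b ∷ bs) ≡ (b ∧ φ k σ) xor F (suc k) bs)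

-- φsum is defined by a function local to Defs; generalising the list it is
-- parametrised by lets unification name that function.
φsum-unfold : ∀ σ b bs → ∃ λ F → WeightedTail σ F × φsum (b ∷ bs) σ ≡ (b ∧ φ 0 σ) xor F 1 bs
φsum-unfold σ b bs = go (b ∷ bs) , ((λ _ → refl) , (λ _ _ _ → refl)) , head-step bs
  where
  go : FinVec → ℕ → List Bool → Bool
  go = _
  head-step : ∀ bs → φsum (b ∷ bs) σ ≡ (b ∧ φ 0 σ) xor go (b ∷ bs) 1 bs
  head-step bs with b ∷ bs | 1
  ... | v | k = refl

weightedTail-vanishes : ∀ {σ} F → (∀ k → φ k σ ≡ false) → WeightedTail σ F → ∀ k bs → F k bs ≡ false
weightedTail-vanishes F φ≡0 (nil , cons) k []       = nil k
weightedTail-vanishes F φ≡0 (nil , cons) k (b ∷ bs) rewrite cons k b bs | φ≡0 k | ∧-zeroʳ b =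
  weightedTail-vanishes F φ≡0 (nil , cons) (suc k) bs

φsum-vanishes : ∀ {σ} → (∀ k → φ k σ ≡ false) → ∀ v → M v σ
φsum-vanishes φ≡0 []             = refl
φsum-vanishes {σ} φ≡0 (b ∷ bs) with φsum-unfold σ b bs
... | F , tail , unfold rewrite unfold | φ≡0 0 | ∧-zeroʳ b = weightedTail-vanishes F φ≡0 tail 1 bs

act-idΩ : ∀ w → act idΩ w ≡ w
act-idΩ []      = refl
act-idΩ (x ∷ w) = cong₂ _∷_ (xor-identityʳ x) (act-idΩ w)

witness-∈-commutator : ∀ n → InCommutator (witness n)
witness-∈-commutator n =
  witness n ∘Ω idΩ , c-mul rootSwap (spike (suc n)) c-id , λ w → cong (witness n) (act-idΩ w)

sectionVector : ∀ N → Ω∞ → Bool → V N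
sectionVector N σ x i = sectSum (toℕ i) σ x

sectionVectors : ∀ N → List Ω∞ → List (V N)
sectionVectors N []      = []
sectionVectors N (s ∷ S) = sectionVector N s false ∷ sectionVector N s true ∷ sectionVectors N S

length-sectionVectors : ∀ N S → length (sectionVectors N S) ≡ 2 * length S
length-sectionVectors N []      = refl
length-sectionVectors N (s ∷ S) =
  trans (cong (λ k → suc (suc k)) (length-sectionVectors N S)) (sym (*-suc 2 (length S)))

sectionVector-∈ : ∀ {N S s} → s ∈ S → ∀ x → sectionVector N s x ∈ sectionVectors N S
sectionVector-∈ (here refl) false = here refl
sectionVector-∈ (here refl) true  = there (here refl)
sectionVector-∈ (there s∈S) x     = there (there (sectionVector-∈ s∈S x))

Gen⇒Span : ∀ {N S g} → Gen S g → ∀ x → Span (sectionVectors N S) (sectionVector N g x)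
Gen⇒Span g-id x = span-0 λ i → levelSum-0 (toℕ i)
Gen⇒Span (g-mul {s} {g} s∈S G) x =
  span-⊕ (sectionVector-∈ s∈S (x xor g [])) (Gen⇒Span G x) λ i → sectSum-∘ (toℕ i) s g x
Gen⇒Span (g-inv {s} {g} s∈S G) x =
  span-⊕ (sectionVector-∈ s∈S ((x xor g []) xor s [])) (Gen⇒Span G x) λ i →
    trans (sectSum-∘ (toℕ i) (invΩ s) g x)
          (cong (sectSum (toℕ i) g x xor_) (sectSum-inv (toℕ i) s (x xor g [])))

sectSum-agree : ∀ {n σ τ} → AgreeUpTo n σ τ → ∀ {m} → suc m < n → ∀ x → sectSum m σ x ≡ sectSum m τ x
sectSum-agree agree {m} m+1<n x =
  levelSum-cong m λ w ∣w∣≡m → agree (x ∷ w) (subst (λ k → suc k < _) (sym ∣w∣≡m) m+1<n)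

δ-toℕ : ∀ {N} (k i : Fin N) → δ (toℕ k) (toℕ i) ≡ unit k i
δ-toℕ k i = does-⇔ (mk⇔ toℕ-injective (cong toℕ)) (toℕ k ≟ℕ toℕ i) (k ≟ᶠ i)

closure-misses-witnesses : ∀ S → ¬ (∀ n → InClosureGen S (witness n))
closure-misses-witnesses S dense =
  n≮n (2 * length S)
      (subst (N ≤_) (length-sectionVectors N S) (units-in-Span⇒≤ (sectionVectors N S) units))
  where
  N = suc (2 * length S)
  units : ∀ k → Span (sectionVectors N S) (unit k)
  units k with dense (toℕ k) (suc N)
  ... | g , G , agree = Span-≗ (Gen⇒Span G false) λ i →
    trans (sectSum-agree agree (s≤s (toℕ<n i)) false)
          (trans (sectSum-witness (toℕ k) (toℕ i) false) (δ-toℕ k i))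

lemma4p2 : (¬ TopFinGen InCommutator)
    × ((I : FinVec → Set) → (∃ λ v → I v) → ¬ TopFinGen M[ I ])
lemma4p2 =
    (λ { (S , _ , dense) → closure-misses-witnesses S λ n → dense (witness n) (witness-∈-commutator n) })
  -- The witnesses lie in every M_v.
  , (λ I _ → λ { (S , _ , dense) →
      closure-misses-witnesses S λ n → dense (witness n) λ v _ → φsum-vanishes (φ-witness n) v })
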